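{- Let $k$ be a positive integer. For every graph $G$, $$f_k(G)\geq d_k\frac{\operatorname{mc}(G)}{k},$$ where $d_k=\frac{k}{k-a_k}$.
   Context: For a graph $G$, a $k$-radius sequence for $G$ is a finite sequence $x_1,\ldots,x_M$ of vertices (repetitions allowed) such that for every edge $uv$ there are $i,j$ with $x_i=u$, $x_j=v$, $|i-j|\leq k$; $f_k(G)$ is the minimum length of such a sequence. $\operatorname{mc}(G)$ is the maximum, over all partitions of $V(G)$ into two sets, of the number of edges joining the two sets. The de Bruijn graph $B_k$ is the directed graph whose vertices are all binary strings of length $k$, with an arc from $u_1\ldots u_k$ to $v_1\ldots v_k$ whenever $u_2\ldots u_k=v_1\ldots v_{k-1}$; this arc is identified with the binary string $e=e_0e_1\ldots e_k=u_1v_1\ldots v_k$. The weight $t_k(e)$ of an arc is the number of $i\in\{1,\ldots,k\}$ with $e_i=e_0$. A cycle in $B_k$ is a closed directed walk with at least one arc and no repeated vertices; its weight $t_k(C)$ is the sum of weights of its arcs and $|C|$ its number of arcs. $a_k=\min\{t_k(C)/|C|: C\text{ a cycle in }B_k\}$. -}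

module Defs where

open import Data.Nat as ℕ using (ℕ; zero; suc; _≤_; ∣_-_∣; _<ᵇ_)
open import Data.Bool using (Bool; true; false; if_then_else_; _∧_; _xor_; _≟_)
open import Data.Fin using (Fin; toℕ)
open import Data.List using (List; length; lookup; map; allFin)
open import Data.Nat.ListAction using (sum)
open import Data.Vec using (Vec; _∷_; init; tail; count)
open import Data.Product using (Σ; ∃; ∃-syntax; _×_)
open import Data.Integer using (+_)
open import Data.Rational as ℚ using (ℚ; _/_)
open import Data.Nat.DivMod using (_mod_)
open import Function.Definitions using (Injective)
open import Relation.Binary.PropositionalEquality using (_≡_)

ΣFin : (m : ℕ) → (Fin m → ℕ) → ℕ
ΣFin m f = sum (map f (allFin m))

record Graph (n : ℕ) : Set where
  field
    adj    : Fin n → Fin n → Bool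
    sym    : ∀ i j → adj i j ≡ adj j i
    irrefl : ∀ i → adj i i ≡ false
open Graph public

IsRadiusSeq : ∀ {n} → ℕ → Graph n → List (Fin n) → Set
IsRadiusSeq k G xs =
  ∀ u v → adj G u v ≡ true →
  ∃[ i ] ∃[ j ] (lookup xs i ≡ u × lookup xs j ≡ v × ∣ toℕ i - toℕ j ∣ ≤ k)

IsFk : ∀ {n} → ℕ → Graph n → ℕ → Set
IsFk k G f =
  (∃[ xs ] (IsRadiusSeq k G xs × length xs ≡ f)) ×
  (∀ xs → IsRadiusSeq k G xs → f ≤ length xs)

cutSize : ∀ {n} → Graph n → (Fin n → Bool) → ℕ
cutSize {n} G S =
  ΣFin n λ i → ΣFin n λ j →
    if (toℕ i <ᵇ toℕ j) ∧ adj G i j ∧ (S i xor S j) then 1 else 0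

IsMaxCut : ∀ {n} → Graph n → ℕ → Set
IsMaxCut G m = (∃[ S ] cutSize G S ≡ m) × (∀ S → cutSize G S ≤ m)

-- de Bruijn graph B_k: vertices Vec Bool k, arcs = Vec Bool (suc k)
-- e = e₀ e₁ … e_k goes from init e = e₀…e_{k-1} to tail e = e₁…e_k.

arcWeight : ∀ {k} → Vec Bool (suc k) → ℕ
arcWeight (x ∷ xs) = count (λ y → y ≟ x) xs

next : ∀ {m} → Fin (suc m) → Fin (suc m)
next {m} i = suc (toℕ i) mod (suc m)

record Cycle (k : ℕ) : Set where
  field
    len'    : ℕ
    arc     : Fin (suc len') → Vec Bool (suc k)
    closed  : ∀ i → tail (arc i) ≡ init (arc (next i))
    simple  : Injective _≡_ _≡_ (λ i → init (arc i))
open Cycle public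

cycleWeight : ∀ {k} → Cycle k → ℕ
cycleWeight C = ΣFin (suc (len' C)) λ i → arcWeight (arc C i)

cycleRatio : ∀ {k} → Cycle k → ℚ
cycleRatio C = (+ cycleWeight C) / suc (len' C)

IsAk : ℕ → ℚ → Set
IsAk k a = (∃[ C ] cycleRatio {k} C ≡ a) × (∀ (C : Cycle k) → a ℚ.≤ cycleRatio C)

-- Let x₀ … x_{f-1} be a k-radius sequence, read cyclically, and S a maximum cut. The bits
-- b_r = S(x_r) form a closed walk of length f in B_k whose p-th arc is the window
-- b_p … b_{p+k}; its weight counts the d ∈ 1 … k with b_{p+d} = b_p, and the remaining
-- pairs (p, p+d) have ends on different sides of the cut. Every cut edge is realised by
-- such a pair, because its ends occur within distance k, so mc(G) + t_k(W) ≤ f k.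
-- A closed walk splits into cycles, each of ratio at least a_k, so t_k(W) ≥ a_k f and
-- mc(G) ≤ (k − a_k) f; dividing by k − a_k, which is positive as a_k ≤ k, gives the claim.
module Submission where

module _ where

  open import Defs hiding (sym)
  open import Data.Bool using (Bool; true; false; if_then_else_; _∧_; _xor_; T)
  import Data.Bool as Bool
  import Data.Bool.Properties as Boolₚ
  open import Data.Empty using (⊥; ⊥-elim)
  open import Data.Fin as Fin using (Fin; toℕ; inject₁; fromℕ)
  import Data.Fin.Properties as Finₚ
  open import Data.Integer as ℤ using (ℤ)
  import Data.Integer.Properties as ℤₚ
  open import Data.Integer.Solver using (module +-*-Solver)
  open import Data.List as List using (List; []; _∷_; length; lookup)
  import Data.List.Properties as Listₚ
  open import Data.Nat as ℕ using (ℕ; zero; suc; _+_; _∸_; _≤_; _<_; z≤n; s≤s; _<ᵇ_)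
  import Data.Nat.Properties as ℕₚ
  open import Data.Nat.DivMod using (_%_; _mod_; n%n≡0; m<n⇒m%n≡m; [m+n]%n≡m%n)
  open import Data.Nat.Induction using (<-rec)
  open import Data.Nat.ListAction using () renaming (sum to sumˡ)
  open import Data.Product using (_×_; _,_; proj₁; proj₂; ∃-syntax; Σ-syntax)
  open import Data.Rational as ℚ using (ℚ; _/_)
  import Data.Rational.Properties as ℚₚ
  open import Data.Rational.Unnormalised as ℚᵘ using (ℚᵘ; mkℚᵘ)
  import Data.Rational.Unnormalised.Properties as ℚᵘₚ
  open import Data.Sum using (_⊎_; inj₁; inj₂)
  open import Data.Unit using (tt)
  open import Data.Vec as Vec using (Vec; _∷_; init; tail; count)
  import Data.Vec.Properties as Vecₚ
  open import Function using (id; _∘_)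
  open import Function.Definitions using (Injective)
  open import Relation.Binary.Definitions using (tri<; tri≈; tri>)
  open import Relation.Binary.PropositionalEquality
  open import Relation.Nullary using (does; yes; no)
  open import Relation.Nullary.Decidable using (dec-true)
  open import Algebra.Properties.CommutativeMonoid.Sum ℕₚ.+-0-commutativeMonoid
    using (sum-syntax; ∑-comm; ∑-distrib-+; sum-cong-≗; sum-replicate-zero)
  open import Algebra.Properties.CommutativeSemigroup ℕₚ.+-commutativeSemigroup using (x∙yz≈y∙xz)

  -- Finite sums over Fin

  ∑-const : ∀ n x → ∑[ i < n ] x ≡ n ℕ.* x
  ∑-const zero    x = refl
  ∑-const (suc n) x = cong (x +_) (∑-const n x)

  ∑-mono-≤ : ∀ {n} {f g : Fin n → ℕ} → (∀ i → f i ≤ g i) → ∑[ i < n ] f i ≤ ∑[ i < n ] g i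
  ∑-mono-≤ {zero}  f≤g = z≤n
  ∑-mono-≤ {suc n} f≤g = ℕₚ.+-mono-≤ (f≤g Fin.zero) (∑-mono-≤ (f≤g ∘ Fin.suc))

  term≤∑ : ∀ {n} (f : Fin n → ℕ) i → f i ≤ ∑[ j < n ] f j
  term≤∑ f Fin.zero    = ℕₚ.m≤m+n _ _
  term≤∑ f (Fin.suc i) = ℕₚ.≤-trans (term≤∑ (f ∘ Fin.suc) i) (ℕₚ.m≤n+m _ (f Fin.zero))

  ∑-δ : ∀ {n} (a : Fin n) x → ∑[ i < n ] (if does (i Finₚ.≟ a) then x else 0) ≡ x
  ∑-δ {suc n} Fin.zero    x = trans (cong (x +_) (sum-replicate-zero n)) (ℕₚ.+-identityʳ x)
  ∑-δ         (Fin.suc a) x = ∑-δ a x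

  ΣFin≡∑ : ∀ n (f : Fin n → ℕ) → ΣFin n f ≡ ∑[ i < n ] f i
  ΣFin≡∑ n f = trans (cong sumˡ (Listₚ.map-tabulate id f)) (sum-tabulate f)
    where
    sum-tabulate : ∀ {m} (g : Fin m → ℕ) → sumˡ (List.tabulate g) ≡ ∑[ i < m ] g i
    sum-tabulate {zero}  g = refl
    sum-tabulate {suc m} g = cong (g Fin.zero +_) (sum-tabulate (g ∘ Fin.suc))

  ∑∑-comm : ∀ {a b c d} (f : Fin a → Fin b → Fin c → Fin d → ℕ) →
    ∑[ i < a ] ∑[ j < b ] ∑[ p < c ] ∑[ q < d ] f i j p q ≡
    ∑[ p < c ] ∑[ q < d ] ∑[ i < a ] ∑[ j < b ] f i j p q
  ∑∑-comm {a} {b} {c} {d} f = begin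
    ∑[ i < a ] ∑[ j < b ] ∑[ p < c ] ∑[ q < d ] f i j p q
      ≡⟨ sum-cong-≗ (λ i → ∑-comm (λ j p → ∑[ q < d ] f i j p q)) ⟩
    ∑[ i < a ] ∑[ p < c ] ∑[ j < b ] ∑[ q < d ] f i j p q
      ≡⟨ ∑-comm (λ i p → ∑[ j < b ] ∑[ q < d ] f i j p q) ⟩
    ∑[ p < c ] ∑[ i < a ] ∑[ j < b ] ∑[ q < d ] f i j p q
      ≡⟨ sum-cong-≗ (λ p → sum-cong-≗ (λ i → ∑-comm (λ j q → f i j p q))) ⟩
    ∑[ p < c ] ∑[ i < a ] ∑[ q < d ] ∑[ j < b ] f i j p q
      ≡⟨ sum-cong-≗ (λ p → ∑-comm (λ i q → ∑[ j < b ] f i j p q)) ⟩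
    ∑[ p < c ] ∑[ q < d ] ∑[ i < a ] ∑[ j < b ] f i j p q ∎
    where open ≡-Reasoning

  ∑∑-δ : ∀ {a b} (x : Fin a) (y : Fin b) v →
    ∑[ i < a ] ∑[ j < b ] (if does (i Finₚ.≟ x) ∧ does (j Finₚ.≟ y) then v else 0) ≡ v
  ∑∑-δ {a} {b} x y v = trans (sum-cong-≗ row) (∑-δ x v)
    where
    row : ∀ i → ∑[ j < b ] (if does (i Finₚ.≟ x) ∧ does (j Finₚ.≟ y) then v else 0) ≡
                (if does (i Finₚ.≟ x) then v else 0)
    row i with does (i Finₚ.≟ x)
    ... | true  = ∑-δ y v
    ... | false = sum-replicate-zero b

  markedPairs≤coverWeight : ∀ {a b c d}
    (marked : Fin a → Fin b → Bool) (pair : Fin c → Fin d → Fin a × Fin b) (w : Fin c → Fin d → ℕ) →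
    (∀ i j → marked i j ≡ true → ∃[ p ] ∃[ q ] pair p q ≡ (i , j) × 1 ≤ w p q) →
    ∑[ i < a ] ∑[ j < b ] (if marked i j then 1 else 0) ≤ ∑[ p < c ] ∑[ q < d ] w p q
  markedPairs≤coverWeight {a} {b} {c} {d} marked pair w covered = begin
    ∑[ i < a ] ∑[ j < b ] (if marked i j then 1 else 0)
      ≤⟨ ∑-mono-≤ (λ i → ∑-mono-≤ (marked≤hits i)) ⟩
    ∑[ i < a ] ∑[ j < b ] ∑[ p < c ] ∑[ q < d ] hit i j p q
      ≡⟨ ∑∑-comm hit ⟩
    ∑[ p < c ] ∑[ q < d ] ∑[ i < a ] ∑[ j < b ] hit i j p q
      ≡⟨ sum-cong-≗ (λ p → sum-cong-≗ (λ q → ∑∑-δ (proj₁ (pair p q)) (proj₂ (pair p q)) (w p q))) ⟩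
    ∑[ p < c ] ∑[ q < d ] w p q
      ∎
    where
    open ℕₚ.≤-Reasoning
    hit : Fin a → Fin b → Fin c → Fin d → ℕ
    hit i j p q = if does (i Finₚ.≟ proj₁ (pair p q)) ∧ does (j Finₚ.≟ proj₂ (pair p q)) then w p q else 0

    hit-at : ∀ {i j p q} → pair p q ≡ (i , j) → hit i j p q ≡ w p q
    hit-at {i} {j} pq≡ij rewrite pq≡ij | dec-true (i Finₚ.≟ i) refl | dec-true (j Finₚ.≟ j) refl = refl

    marked≤hits : ∀ i j → (if marked i j then 1 else 0) ≤ ∑[ p < c ] ∑[ q < d ] hit i j p q
    marked≤hits i j with marked i j in eq
    ... | false = z≤n
    ... | true with covered i j eq
    ...   | p , q , pq≡ij , 1≤w = begin
      1                                       ≤⟨ 1≤w ⟩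
      w p q                                   ≡⟨ hit-at pq≡ij ⟨
      hit i j p q                             ≤⟨ term≤∑ (hit i j p) q ⟩
      ∑[ q < d ] hit i j p q                  ≤⟨ term≤∑ (λ p → ∑[ q < d ] hit i j p q) p ⟩
      ∑[ p < c ] ∑[ q < d ] hit i j p q       ∎

  -- Windows of a binary stream

  window : ∀ {m} → (ℕ → Bool) → Vec Bool m
  window b = Vec.tabulate (b ∘ toℕ)

  init-window : ∀ {m} (b : ℕ → Bool) → init (window {suc m} b) ≡ window b
  init-window {zero}  b = refl
  init-window {suc m} b = cong (b 0 ∷_) (init-window (b ∘ suc))

  disagreements : ∀ m → (ℕ → Bool) → ℕ
  disagreements m b = ∑[ d < m ] (if b 0 xor b (suc (toℕ d)) then 1 else 0)

  count-agree+disagree : ∀ {m} x (g : Fin m → Bool) →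
    count (Bool._≟ x) (Vec.tabulate g) + ∑[ d < m ] (if x xor g d then 1 else 0) ≡ m
  count-agree+disagree {zero}  x g = refl
  count-agree+disagree {suc m} x g = step x (g Fin.zero) (count-agree+disagree x (g ∘ Fin.suc))
    where
    step : ∀ x y {c s} → c + s ≡ m →
      (if does (y Bool.≟ x) then suc else id) c + ((if x xor y then 1 else 0) + s) ≡ suc m
    step false false eq = cong suc eq
    step false true  eq = trans (ℕₚ.+-suc _ _) (cong suc eq)
    step true  false eq = trans (ℕₚ.+-suc _ _) (cong suc eq)
    step true  true  eq = cong suc eq

  arcWeight-window : ∀ m (b : ℕ → Bool) → arcWeight (window {suc m} b) + disagreements m b ≡ m
  arcWeight-window m b = count-agree+disagree (b 0) (b ∘ suc ∘ toℕ)

  -- Walks in the de Bruijn graph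

  RatioAtLeast : ℤ → ℤ → ℕ → ℕ → Set
  RatioAtLeast P Q L T = P ℤ.* ℤ.+ L ℤ.≤ ℤ.+ T ℤ.* Q

  RatioAtLeast-zero : ∀ {P Q} → RatioAtLeast P Q 0 0
  RatioAtLeast-zero {P} {Q} = ℤₚ.≤-reflexive (trans (ℤₚ.*-zeroʳ P) (sym (ℤₚ.*-zeroˡ Q)))

  RatioAtLeast-+ : ∀ {P Q L₁ L₂ T₁ T₂} → RatioAtLeast P Q L₁ T₁ → RatioAtLeast P Q L₂ T₂ →
    RatioAtLeast P Q (L₁ + L₂) (T₁ + T₂)
  RatioAtLeast-+ {P} {Q} {L₁} {L₂} {T₁} {T₂} r₁ r₂ = begin
    P ℤ.* ℤ.+ (L₁ + L₂)                     ≡⟨ cong (P ℤ.*_) (ℤₚ.pos-+ L₁ L₂) ⟩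
    P ℤ.* (ℤ.+ L₁ ℤ.+ ℤ.+ L₂)               ≡⟨ ℤₚ.*-distribˡ-+ P (ℤ.+ L₁) (ℤ.+ L₂) ⟩
    P ℤ.* ℤ.+ L₁ ℤ.+ P ℤ.* ℤ.+ L₂           ≤⟨ ℤₚ.+-mono-≤ r₁ r₂ ⟩
    ℤ.+ T₁ ℤ.* Q ℤ.+ ℤ.+ T₂ ℤ.* Q           ≡⟨ ℤₚ.*-distribʳ-+ Q (ℤ.+ T₁) (ℤ.+ T₂) ⟨
    (ℤ.+ T₁ ℤ.+ ℤ.+ T₂) ℤ.* Q               ≡⟨ cong (ℤ._* Q) (ℤₚ.pos-+ T₁ T₂) ⟨
    ℤ.+ (T₁ + T₂) ℤ.* Q                     ∎
    where open ℤₚ.≤-Reasoning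

  private
    variable
      n : ℕ

  next-wraps : ∀ {m} (i : Fin (suc m)) →
    (i ≡ fromℕ m × next i ≡ Fin.zero) ⊎ Fin.suc i ≡ inject₁ (next i)
  next-wraps {m} i with ℕₚ.m≤n⇒m<n∨m≡n (Finₚ.toℕ≤pred[n] i)
  ... | inj₁ i<m = inj₂ (Finₚ.toℕ-injective (begin
    suc (toℕ i)              ≡⟨ m<n⇒m%n≡m (s≤s i<m) ⟨
    suc (toℕ i) % suc m      ≡⟨ Finₚ.toℕ-fromℕ< _ ⟨
    toℕ (next i)             ≡⟨ Finₚ.toℕ-inject₁ (next i) ⟨
    toℕ (inject₁ (next i))   ∎))
    where open ≡-Reasoning
  ... | inj₂ i≡m = inj₁ (Finₚ.toℕ-injective (trans i≡m (sym (Finₚ.toℕ-fromℕ m))) , Finₚ.toℕ-injective (begin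
    toℕ (next i)             ≡⟨ Finₚ.toℕ-fromℕ< _ ⟩
    suc (toℕ i) % suc m      ≡⟨ cong (λ j → suc j % suc m) i≡m ⟩
    suc m % suc m            ≡⟨ n%n≡0 (suc m) ⟩
    0                        ∎))
    where open ≡-Reasoning

  +-reassoc : ∀ a {x y z} → x ≡ y + z → a + x ≡ a + y + z
  +-reassoc a {y = y} {z} x≡y+z = trans (cong (a +_) x≡y+z) (sym (ℕₚ.+-assoc a y z))

  module _ {k : ℕ} where

    private
      variable
        u v w y : Vec Bool k

    data Walk : ℕ → Vec Bool k → Vec Bool k → Set where
      nil  : Walk 0 u u
      cons : (e : Vec Bool (suc k)) → init e ≡ u → tail e ≡ v → Walk n v w → Walk (suc n) u w

    weight : Walk n u w → ℕ
    weight nil            = 0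
    weight (cons e _ _ W) = arcWeight e + weight W

    arcAt : Walk n u w → Fin n → Vec Bool (suc k)
    arcAt (cons e _ _ W) Fin.zero    = e
    arcAt (cons e _ _ W) (Fin.suc i) = arcAt W i

    vertexAt : Walk n u w → Fin (suc n) → Vec Bool k
    vertexAt {u = u} _      Fin.zero    = u
    vertexAt (cons _ _ _ W) (Fin.suc i) = vertexAt W i
    vertexAt nil            (Fin.suc ())

    source : Walk n u w → Fin n → Vec Bool k
    source W = init ∘ arcAt W

    source≡vertexAt : (W : Walk n u w) (i : Fin n) → source W i ≡ vertexAt W (inject₁ i)
    source≡vertexAt (cons e p _ W) Fin.zero    = p
    source≡vertexAt (cons e _ _ W) (Fin.suc i) = source≡vertexAt W i

    target≡vertexAt : (W : Walk n u w) (i : Fin n) → tail (arcAt W i) ≡ vertexAt W (Fin.suc i)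
    target≡vertexAt (cons e _ q W) Fin.zero    = q
    target≡vertexAt (cons e _ _ W) (Fin.suc i) = target≡vertexAt W i

    vertexAt-last : (W : Walk n u w) → vertexAt W (fromℕ n) ≡ w
    vertexAt-last nil            = refl
    vertexAt-last (cons _ _ _ W) = vertexAt-last W

    weight≡∑ : (W : Walk n u w) → weight W ≡ ∑[ i < n ] arcWeight (arcAt W i)
    weight≡∑ nil            = refl
    weight≡∑ (cons e _ _ W) = cong (arcWeight e +_) (weight≡∑ W)

    _++ʷ_ : ∀ {m} → Walk n u v → Walk m v w → Walk (n + m) u w
    nil          ++ʷ W′ = W′
    cons e p q W ++ʷ W′ = cons e p q (W ++ʷ W′)

    weight-++ʷ : ∀ {m} (W : Walk n u v) (W′ : Walk m v w) → weight (W ++ʷ W′) ≡ weight W + weight W′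
    weight-++ʷ nil            W′ = refl
    weight-++ʷ (cons e _ _ W) W′ = +-reassoc (arcWeight e) (weight-++ʷ W W′)

    record Split (W : Walk n u w) (y : Vec Bool k) : Set where
      field
        l₁ l₂        : ℕ
        prefix       : Walk l₁ u y
        suffix       : Walk (suc l₂) y w
        length-split : l₁ + suc l₂ ≡ n
        weight-split : weight W ≡ weight prefix + weight suffix

    splitAt : (W : Walk n u w) (i : Fin n) → source W i ≡ y → Split W y
    splitAt (cons e refl q W) Fin.zero refl = record
      { l₁ = 0 ; l₂ = _ ; prefix = nil ; suffix = cons e refl q W
      ; length-split = refl ; weight-split = refl }
    splitAt (cons e p q W) (Fin.suc i) eq = record
      { l₁ = suc l₁ ; l₂ = l₂ ; prefix = cons e p q prefix ; suffix = suffix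
      ; length-split = cong suc length-split
      ; weight-split = +-reassoc (arcWeight e) weight-split }
      where open Split (splitAt W i eq)

    record Loop (W : Walk n u w) : Set where
      field
        a b c       : ℕ
        base        : Vec Bool k
        before      : Walk a u base
        loop        : Walk (suc b) base base
        after       : Walk (suc c) base w
        length-loop : a + (suc b + suc c) ≡ n
        weight-loop : weight W ≡ weight before + (weight loop + weight after)

    findLoop : (W : Walk n u w) → Injective _≡_ _≡_ (source W) ⊎ Loop W
    findLoop nil = inj₁ λ { {()} }
    findLoop {u = u} (cons e p q W) with findLoop W
    ... | inj₂ L = inj₂ record
      { a = suc a ; b = b ; c = c ; base = base
      ; before = cons e p q before ; loop = loop ; after = after
      ; length-loop = cong suc length-loop
      ; weight-loop = +-reassoc (arcWeight e) weight-loop }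
      where open Loop L
    ... | inj₁ W-simple with Finₚ.any? (λ i → Vecₚ.≡-dec Bool._≟_ (source W i) u)
    ...   | yes (i , revisits) = inj₂ record
      { a = 0 ; b = l₁ ; c = l₂ ; base = u
      ; before = nil ; loop = cons e p q prefix ; after = suffix
      ; length-loop = cong suc length-split
      ; weight-loop = +-reassoc (arcWeight e) weight-split }
      where open Split (splitAt W i revisits)
    ...   | no fresh = inj₁ sources-distinct
      where
      sources-distinct : Injective _≡_ _≡_ (source (cons e p q W))
      sources-distinct {Fin.zero}  {Fin.zero}  _  = refl
      sources-distinct {Fin.zero}  {Fin.suc j} eq = ⊥-elim (fresh (j , trans (sym eq) p))
      sources-distinct {Fin.suc i} {Fin.zero}  eq = ⊥-elim (fresh (i , trans eq p))
      sources-distinct {Fin.suc i} {Fin.suc j} eq = cong Fin.suc (W-simple eq)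

    toCycle : (W : Walk (suc n) u u) → Injective _≡_ _≡_ (source W) → Cycle k
    toCycle {n} {u} W distinct = record { len' = n ; arc = arcAt W ; closed = closes ; simple = distinct }
      where
      closes : ∀ i → tail (arcAt W i) ≡ init (arcAt W (next i))
      closes i with next-wraps i
      ... | inj₁ (refl , next≡0) = begin
        tail (arcAt W (fromℕ n))      ≡⟨ target≡vertexAt W (fromℕ n) ⟩
        vertexAt W (fromℕ (suc n))    ≡⟨ vertexAt-last W ⟩
        u                             ≡⟨ source≡vertexAt W Fin.zero ⟨
        source W Fin.zero             ≡⟨ cong (source W) next≡0 ⟨
        source W (next (fromℕ n))     ∎
        where open ≡-Reasoning
      ... | inj₂ suc≡next = begin
        tail (arcAt W i)              ≡⟨ target≡vertexAt W i ⟩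
        vertexAt W (Fin.suc i)        ≡⟨ cong (vertexAt W) suc≡next ⟩
        vertexAt W (inject₁ (next i)) ≡⟨ source≡vertexAt W (next i) ⟨
        source W (next i)             ∎
        where open ≡-Reasoning

    cycleWeight-toCycle : (W : Walk (suc n) u u) (distinct : Injective _≡_ _≡_ (source W)) →
      cycleWeight (toCycle W distinct) ≡ weight W
    cycleWeight-toCycle {n} W _ = trans (ΣFin≡∑ (suc n) (arcWeight ∘ arcAt W)) (sym (weight≡∑ W))

    -- Induction on length: a closed walk is a cycle or the splice of two shorter closed walks.
    closedWalk-ratio : ∀ {P Q} → (∀ (C : Cycle k) → RatioAtLeast P Q (suc (len' C)) (cycleWeight C)) →
      (W : Walk n u u) → RatioAtLeast P Q n (weight W)
    closedWalk-ratio {n = n} {P = P} {Q = Q} cycles = <-rec Goal step n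
      where
      Goal : ℕ → Set
      Goal n = ∀ {u} (W : Walk n u u) → RatioAtLeast P Q n (weight W)

      step : ∀ n → (∀ {m} → m < n → Goal m) → Goal n
      step _ _ nil = RatioAtLeast-zero {P} {Q}
      step _ rec W@(cons _ _ _ _) with findLoop W
      ... | inj₁ distinct =
        subst (RatioAtLeast P Q _) (cycleWeight-toCycle W distinct) (cycles (toCycle W distinct))
      ... | inj₂ L = subst₂ (RatioAtLeast P Q) length-eq weight-eq
                       (RatioAtLeast-+ {P} {Q} {T₁ = weight loop} {weight rest}
                          (rec loop-shorter loop) (rec rest-shorter rest))
        where
        open Loop L
        rest : Walk (a + suc c) _ _
        rest = before ++ʷ after
        length-eq : suc b + (a + suc c) ≡ _
        length-eq = trans (x∙yz≈y∙xz (suc b) a (suc c)) length-loop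
        weight-eq : weight loop + weight rest ≡ weight W
        weight-eq = trans (cong (weight loop +_) (weight-++ʷ before after))
                          (trans (x∙yz≈y∙xz (weight loop) (weight before) (weight after)) (sym weight-loop))
        loop-shorter : suc b < _
        loop-shorter = subst (suc b <_) length-eq
                         (ℕₚ.m<m+n (suc b) (ℕₚ.≤-trans (s≤s z≤n) (ℕₚ.m≤n+m (suc c) a)))
        rest-shorter : a + suc c < _
        rest-shorter = subst (a + suc c <_) length-eq (ℕₚ.m<n+m (a + suc c) {suc b} (s≤s z≤n))

    -- Shifting the stream, rather than indexing into it, makes consecutive windows agree definitionally.
    streamWalk : (b : ℕ → Bool) (r : ℕ) → Walk r (window b) (window (b ∘ (r +_)))
    streamWalk b zero    = nil
    streamWalk b (suc r) = cons (window b) (init-window b) refl (streamWalk (b ∘ suc) r)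

    weight-streamWalk : (b : ℕ → Bool) (r : ℕ) →
      weight (streamWalk b r) ≡ ∑[ p < r ] arcWeight (window {suc k} (b ∘ (toℕ p +_)))
    weight-streamWalk b zero    = refl
    weight-streamWalk b (suc r) = cong (arcWeight (window {suc k} b) +_) (weight-streamWalk (b ∘ suc) r)

    weight-subst : (eq : w ≡ y) (W : Walk n u w) → weight (subst (Walk n u) eq W) ≡ weight W
    weight-subst refl W = refl

  -- Radius sequences and cuts

  bounded-gap : ∀ {a b k} → a < b → ℕ.∣ a - b ∣ ≤ k → ∃[ d ] d < k × a + suc d ≡ b
  bounded-gap {a} {b} {k} a<b dist = b ∸ suc a , d<k , a+1+d≡b
    where
    a+1+d≡b : a + suc (b ∸ suc a) ≡ b
    a+1+d≡b = trans (ℕₚ.+-suc a _) (ℕₚ.m+[n∸m]≡n a<b)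
    d<k : b ∸ suc a < k
    d<k = subst (_≤ k) (begin
      ℕ.∣ a - b ∣                    ≡⟨ ℕₚ.m≤n⇒∣m-n∣≡n∸m (ℕₚ.<⇒≤ a<b) ⟩
      b ∸ a                          ≡⟨ cong (_∸ a) a+1+d≡b ⟨
      a + suc (b ∸ suc a) ∸ a        ≡⟨ ℕₚ.m+n∸m≡n a _ ⟩
      suc (b ∸ suc a)                ∎) dist
      where open ≡-Reasoning

  mod-toℕ : ∀ {M r} .{{_ : ℕ.NonZero M}} (I : Fin M) → r ≡ toℕ I → r mod M ≡ I
  mod-toℕ I refl = Finₚ.toℕ-injective (trans (Finₚ.toℕ-fromℕ< _) (m<n⇒m%n≡m (Finₚ.toℕ<n I)))

  mod-period : ∀ M r .{{_ : ℕ.NonZero M}} → (M + r) mod M ≡ r mod M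
  mod-period M r = Finₚ.toℕ-injective (begin
    toℕ ((M + r) mod M)   ≡⟨ Finₚ.toℕ-fromℕ< _ ⟩
    (M + r) % M           ≡⟨ cong (_% M) (ℕₚ.+-comm M r) ⟩
    (r + M) % M           ≡⟨ [m+n]%n≡m%n r M ⟩
    r % M                 ≡⟨ Finₚ.toℕ-fromℕ< _ ⟨
    toℕ (r mod M)         ∎)
    where open ≡-Reasoning

  orderedPair : ∀ {n} → Fin n → Fin n → Fin n × Fin n
  orderedPair x y = if toℕ x <ᵇ toℕ y then (x , y) else (y , x)

  orderedPair-< : ∀ {n} {i j : Fin n} → toℕ i < toℕ j →
    orderedPair i j ≡ (i , j) × orderedPair j i ≡ (i , j)
  orderedPair-< {i = i} {j} i<j with toℕ i <ᵇ toℕ j in ij | toℕ j <ᵇ toℕ i in ji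
  ... | true  | false = refl , refl
  ... | false | _     = ⊥-elim (subst T ij (ℕₚ.<⇒<ᵇ i<j))
  ... | true  | true  = ⊥-elim (ℕₚ.<-asym i<j (ℕₚ.<ᵇ⇒< _ _ (subst T (sym ji) tt)))

  isCutEdge : ∀ {n} → Graph n → (Fin n → Bool) → Fin n → Fin n → Bool
  isCutEdge G S i j = (toℕ i <ᵇ toℕ j) ∧ adj G i j ∧ (S i xor S j)

  cutSize≡∑∑ : ∀ {n} (G : Graph n) S →
    cutSize G S ≡ ∑[ i < n ] ∑[ j < n ] (if isCutEdge G S i j then 1 else 0)
  cutSize≡∑∑ {n} G S = trans (ΣFin≡∑ n (λ i → ΣFin n (cut i))) (sum-cong-≗ (λ i → ΣFin≡∑ n (cut i)))
    where
    cut : Fin n → Fin n → ℕ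
    cut i j = if isCutEdge G S i j then 1 else 0

  isCutEdge⇒ : ∀ {n} (G : Graph n) S i j → isCutEdge G S i j ≡ true →
    toℕ i < toℕ j × adj G i j ≡ true × S i xor S j ≡ true
  isCutEdge⇒ G S i j cut with toℕ i <ᵇ toℕ j in ij | adj G i j | S i xor S j
  isCutEdge⇒ G S i j refl | true | true | true = ℕₚ.<ᵇ⇒< _ _ (subst T (sym ij) tt) , refl , refl

  module _ {k n : ℕ} (G : Graph n) (S : Fin n → Bool) (xs : List (Fin n)) .{{_ : ℕ.NonZero (length xs)}} where

    private
      M : ℕ
      M = length xs

    entry : ℕ → Fin n
    entry r = lookup xs (r mod M)

    bit : ℕ → Bool
    bit = S ∘ entry

    window-period : window {k} (bit ∘ (M +_)) ≡ window bit
    window-period = Vecₚ.tabulate-cong (λ d → cong (S ∘ lookup xs) (mod-period M (toℕ d)))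

    sequenceWalk : Walk M (window {k} bit) (window bit)
    sequenceWalk = subst (Walk M (window bit)) window-period (streamWalk bit M)

    -- Written with toℕ p + 0 so that its first bit is the head of the window of bit ∘ (toℕ p +_).
    crossings : Fin M → Fin k → ℕ
    crossings p d = if bit (toℕ p + 0) xor bit (toℕ p + suc (toℕ d)) then 1 else 0

    weight+crossings : weight sequenceWalk + ∑[ p < M ] ∑[ d < k ] crossings p d ≡ M ℕ.* k
    weight+crossings = begin
      weight sequenceWalk + ∑[ p < M ] ∑[ d < k ] crossings p d
        ≡⟨ cong (_+ ∑[ p < M ] disagree p)
                (trans (weight-subst window-period (streamWalk bit M)) (weight-streamWalk bit M)) ⟩
      ∑[ p < M ] agree p + ∑[ p < M ] disagree p  ≡⟨ ∑-distrib-+ agree disagree ⟨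
      ∑[ p < M ] (agree p + disagree p)           ≡⟨ sum-cong-≗ {M} (λ p → arcWeight-window k (bit ∘ (toℕ p +_))) ⟩
      ∑[ p < M ] k                                ≡⟨ ∑-const M k ⟩
      M ℕ.* k                                     ∎
      where
      open ≡-Reasoning
      agree disagree : Fin M → ℕ
      agree p = arcWeight (window {suc k} (bit ∘ (toℕ p +_)))
      disagree p = disagreements k (bit ∘ (toℕ p +_))

    pairAt : Fin M → Fin k → Fin n × Fin n
    pairAt p d = orderedPair (entry (toℕ p + 0)) (entry (toℕ p + suc (toℕ d)))

    entries-at : (I J : Fin M) → toℕ I < toℕ J → ℕ.∣ toℕ I - toℕ J ∣ ≤ k →
      ∃[ d ] entry (toℕ I + 0) ≡ lookup xs I × entry (toℕ I + suc (toℕ d)) ≡ lookup xs J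
    entries-at I J I<J dist with bounded-gap I<J dist
    ... | d , d<k , I+1+d≡J =
      Fin.fromℕ< d<k ,
      cong (lookup xs) (mod-toℕ I (ℕₚ.+-identityʳ (toℕ I))) ,
      cong (lookup xs) (mod-toℕ J (trans (cong (λ e → toℕ I + suc e) (Finₚ.toℕ-fromℕ< d<k)) I+1+d≡J))

    crossing-at : ∀ p d {x y} → entry (toℕ p + 0) ≡ x → entry (toℕ p + suc (toℕ d)) ≡ y →
      S x xor S y ≡ true → pairAt p d ≡ orderedPair x y × 1 ≤ crossings p d
    crossing-at p d refl refl split rewrite split = refl , s≤s z≤n

    cutEdges-covered : IsRadiusSeq k G xs → ∀ i j → isCutEdge G S i j ≡ true →
      ∃[ p ] ∃[ d ] pairAt p d ≡ (i , j) × 1 ≤ crossings p d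
    cutEdges-covered R i j cut with isCutEdge⇒ G S i j cut
    ... | i<j , edge , split with R i j edge
    ... | I , J , I↦i , J↦j , dist with ℕₚ.<-cmp (toℕ I) (toℕ J)
    ... | tri< I<J _ _ =
      let d , eI , eJ = entries-at I J I<J dist
          pair≡ , crosses = crossing-at I d (trans eI I↦i) (trans eJ J↦j) split
      in I , d , trans pair≡ (proj₁ (orderedPair-< i<j)) , crosses
    ... | tri> _ _ J<I =
      let d , eJ , eI = entries-at J I J<I (subst (_≤ k) (ℕₚ.∣-∣-comm (toℕ I) (toℕ J)) dist)
          pair≡ , crosses = crossing-at J d (trans eJ J↦j) (trans eI I↦i)
                                          (trans (Boolₚ.xor-comm (S j) (S i)) split)
      in J , d , trans pair≡ (proj₂ (orderedPair-< i<j)) , crosses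
    ... | tri≈ _ I≡J _ = ⊥-elim (ℕₚ.<-irrefl (cong toℕ i≡j) i<j)
      where
      i≡j : i ≡ j
      i≡j = trans (sym I↦i) (trans (cong (lookup xs) (Finₚ.toℕ-injective I≡J)) J↦j)

    cutSize+weight≤ : IsRadiusSeq k G xs → cutSize G S + weight sequenceWalk ≤ M ℕ.* k
    cutSize+weight≤ R = begin
      cutSize G S + weight sequenceWalk
        ≡⟨ cong (_+ weight sequenceWalk) (cutSize≡∑∑ G S) ⟩
      ∑[ i < n ] ∑[ j < n ] (if isCutEdge G S i j then 1 else 0) + weight sequenceWalk
        ≤⟨ ℕₚ.+-monoˡ-≤ (weight sequenceWalk)
             (markedPairs≤coverWeight (isCutEdge G S) pairAt crossings (cutEdges-covered R)) ⟩
      ∑[ p < M ] ∑[ d < k ] crossings p d + weight sequenceWalk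
        ≡⟨ ℕₚ.+-comm _ (weight sequenceWalk) ⟩
      weight sequenceWalk + ∑[ p < M ] ∑[ d < k ] crossings p d
        ≡⟨ weight+crossings ⟩
      M ℕ.* k ∎
      where open ℕₚ.≤-Reasoning

  radiusSeq⇒closedWalk : ∀ {k n} (G : Graph n) (S : Fin n → Bool) (xs : List (Fin n)) → IsRadiusSeq k G xs →
    Σ[ u ∈ Vec Bool k ] Σ[ W ∈ Walk (length xs) u u ] cutSize G S + weight W ≤ length xs ℕ.* k
  radiusSeq⇒closedWalk {k} G S [] R =
    Vec.replicate k false , nil ,
    ℕₚ.≤-trans (ℕₚ.≤-reflexive (trans (ℕₚ.+-identityʳ _) (cutSize≡∑∑ G S)))
               (markedPairs≤coverWeight {c = 0} {d = k} (isCutEdge G S) (λ ()) (λ ()) (λ i j → ⊥-elim ∘ no-cutEdge i j))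
    where
    no-cutEdge : ∀ i j → isCutEdge G S i j ≡ true → ⊥
    no-cutEdge i j cut with R i j (proj₁ (proj₂ (isCutEdge⇒ G S i j cut)))
    ... | () , _
  radiusSeq⇒closedWalk G S xs@(_ ∷ _) R = _ , sequenceWalk G S xs , cutSize+weight≤ G S xs R

  cutSize-boundℤ : ∀ {k n P Q} .{{_ : ℤ.NonNegative Q}} (G : Graph n) (S : Fin n → Bool) (xs : List (Fin n)) →
    (∀ (C : Cycle k) → RatioAtLeast P Q (suc (len' C)) (cycleWeight C)) → IsRadiusSeq k G xs →
    ℤ.+ cutSize G S ℤ.* Q ℤ.+ P ℤ.* ℤ.+ length xs ℤ.≤ ℤ.+ (length xs ℕ.* k) ℤ.* Q
  cutSize-boundℤ {k} {P = P} {Q} G S xs cycles R with radiusSeq⇒closedWalk G S xs R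
  ... | _ , W , bound = begin
    ℤ.+ cut ℤ.* Q ℤ.+ P ℤ.* ℤ.+ length xs    ≤⟨ ℤₚ.+-monoʳ-≤ (ℤ.+ cut ℤ.* Q)
                                                   (closedWalk-ratio {P = P} {Q = Q} cycles W) ⟩
    ℤ.+ cut ℤ.* Q ℤ.+ ℤ.+ weight W ℤ.* Q     ≡⟨ ℤₚ.*-distribʳ-+ Q (ℤ.+ cut) (ℤ.+ weight W) ⟨
    (ℤ.+ cut ℤ.+ ℤ.+ weight W) ℤ.* Q         ≡⟨ cong (ℤ._* Q) (ℤₚ.pos-+ cut (weight W)) ⟨
    ℤ.+ (cut + weight W) ℤ.* Q               ≤⟨ ℤₚ.*-monoʳ-≤-nonNeg Q (ℤ.+≤+ bound) ⟩
    ℤ.+ (length xs ℕ.* k) ℤ.* Q              ∎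
    where
    open ℤₚ.≤-Reasoning
    cut = cutSize G S

  -- Rational arithmetic

  /-≤-/ : ∀ p q m n → p ℤ.* ℤ.+ suc n ℤ.≤ q ℤ.* ℤ.+ suc m → p / suc m ℚ.≤ q / suc n
  /-≤-/ p q m n le = ℚₚ.toℚᵘ-cancel-≤
    (ℚᵘₚ.≤-respˡ-≃ (ℚᵘₚ.≃-sym (ℚₚ.toℚᵘ-fromℚᵘ (mkℚᵘ p m)))
      (ℚᵘₚ.≤-respʳ-≃ (ℚᵘₚ.≃-sym (ℚₚ.toℚᵘ-fromℚᵘ (mkℚᵘ q n))) (ℚᵘ.*≤* le)))

  /-≤-/⁻¹ : ∀ p q m n → p / suc m ℚ.≤ q / suc n → p ℤ.* ℤ.+ suc n ℤ.≤ q ℤ.* ℤ.+ suc m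
  /-≤-/⁻¹ p q m n le with ℚᵘₚ.≤-respˡ-≃ (ℚₚ.toℚᵘ-fromℚᵘ (mkℚᵘ p m))
                           (ℚᵘₚ.≤-respʳ-≃ (ℚₚ.toℚᵘ-fromℚᵘ (mkℚᵘ q n)) (ℚₚ.toℚᵘ-mono-≤ le))
  ... | ℚᵘ.*≤* le′ = le′

  ≤-cycleRatio⇒RatioAtLeast : ∀ {k} a (C : Cycle k) → a ℚ.≤ cycleRatio C →
    RatioAtLeast (ℚ.↥ a) (ℚ.↧ a) (suc (len' C)) (cycleWeight C)
  ≤-cycleRatio⇒RatioAtLeast a C a≤C =
    /-≤-/⁻¹ (ℚ.↥ a) (ℤ.+ cycleWeight C) (ℚ.denominator-1 a) (len' C)
      (subst (ℚ._≤ cycleRatio C) (sym (ℚₚ.↥p/↧p≡p a)) a≤C)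

  cycleWeight≤ : ∀ {k} (C : Cycle k) → cycleWeight C ≤ suc (len' C) ℕ.* k
  cycleWeight≤ {k} C = begin
    cycleWeight C                                  ≡⟨ ΣFin≡∑ (suc (len' C)) (arcWeight ∘ arc C) ⟩
    ∑[ i < suc (len' C) ] arcWeight (arc C i)      ≤⟨ ∑-mono-≤ (arcWeight≤ ∘ arc C) ⟩
    ∑[ i < suc (len' C) ] k                        ≡⟨ ∑-const (suc (len' C)) k ⟩
    suc (len' C) ℕ.* k                             ∎
    where
    open ℕₚ.≤-Reasoning
    arcWeight≤ : (e : Vec Bool (suc k)) → arcWeight e ≤ k
    arcWeight≤ (x ∷ xs) = Vecₚ.count≤n _ xs

  cycleRatio≤k : ∀ {k} (C : Cycle k) → cycleRatio C ℚ.≤ ℤ.+ k / 1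
  cycleRatio≤k {k} C = /-≤-/ (ℤ.+ cycleWeight C) (ℤ.+ k) (len' C) 0 (begin
    ℤ.+ cycleWeight C ℤ.* ℤ.+ 1    ≡⟨ ℤₚ.*-identityʳ _ ⟩
    ℤ.+ cycleWeight C              ≤⟨ ℤ.+≤+ (cycleWeight≤ C) ⟩
    ℤ.+ (suc (len' C) ℕ.* k)       ≡⟨ cong ℤ.+_ (ℕₚ.*-comm (suc (len' C)) k) ⟩
    ℤ.+ (k ℕ.* suc (len' C))       ≡⟨ ℤₚ.pos-* k (suc (len' C)) ⟩
    ℤ.+ k ℤ.* ℤ.+ suc (len' C)     ∎)
    where open ℤₚ.≤-Reasoning

  m≤[k-a]*f : ∀ (a : ℚ) (m f k : ℕ) →
    ℤ.+ m ℤ.* ℚ.↧ a ℤ.+ ℚ.↥ a ℤ.* ℤ.+ f ℤ.≤ ℤ.+ (f ℕ.* k) ℤ.* ℚ.↧ a →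
    ℤ.+ m / 1 ℚ.≤ (ℤ.+ k / 1 ℚ.- a) ℚ.* (ℤ.+ f / 1)
  m≤[k-a]*f a@record{} m f k bound = ℚₚ.toℚᵘ-cancel-≤
    (ℚᵘₚ.≤-respˡ-≃ (ℚᵘₚ.≃-sym (ℚₚ.toℚᵘ-fromℚᵘ (mkℚᵘ (ℤ.+ m) 0)))
      (ℚᵘₚ.≤-respʳ-≃ (ℚᵘₚ.≃-sym toℚᵘ-rhs) (ℚᵘ.*≤* cleared)))
    where
    open +-*-Solver
    P = ℚ.↥ a
    Q = ℚ.↧ a

    R : ℚᵘ
    R = (mkℚᵘ (ℤ.+ k) 0 ℚᵘ.- ℚ.toℚᵘ a) ℚᵘ.* mkℚᵘ (ℤ.+ f) 0

    toℚᵘ-rhs : ℚ.toℚᵘ ((ℤ.+ k / 1 ℚ.- a) ℚ.* (ℤ.+ f / 1)) ℚᵘ.≃ R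
    toℚᵘ-rhs = ℚᵘₚ.≃-trans (ℚₚ.toℚᵘ-homo-* (ℤ.+ k / 1 ℚ.- a) (ℤ.+ f / 1))
      (ℚᵘₚ.*-cong (ℚᵘₚ.≃-trans (ℚₚ.toℚᵘ-homo-+ (ℤ.+ k / 1) (ℚ.- a))
                    (ℚᵘₚ.+-cong (ℚₚ.toℚᵘ-fromℚᵘ (mkℚᵘ (ℤ.+ k) 0)) (ℚₚ.toℚᵘ-homo‿- a)))
                  (ℚₚ.toℚᵘ-fromℚᵘ (mkℚᵘ (ℤ.+ f) 0)))

    ↧R≡Q : ℚᵘ.↧ R ≡ Q
    ↧R≡Q = cong (ℤ.+_ ∘ suc) (trans (ℕₚ.*-identityʳ _) (ℕₚ.+-identityʳ _))

    cleared : ℤ.+ m ℤ.* ℚᵘ.↧ R ℤ.≤ ℚᵘ.↥ R ℤ.* ℤ.+ 1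
    cleared = subst₂ ℤ._≤_ lhs rhs (ℤₚ.+-monoˡ-≤ (ℤ.- (P ℤ.* ℤ.+ f)) bound)
      where
      lhs : ℤ.+ m ℤ.* Q ℤ.+ P ℤ.* ℤ.+ f ℤ.- P ℤ.* ℤ.+ f ≡ ℤ.+ m ℤ.* ℚᵘ.↧ R
      lhs = trans (solve 3 (λ x y z → x :+ y :* z :- y :* z := x) refl (ℤ.+ m ℤ.* Q) P (ℤ.+ f))
                  (cong (ℤ.+ m ℤ.*_) (sym ↧R≡Q))
      rhs : ℤ.+ (f ℕ.* k) ℤ.* Q ℤ.- P ℤ.* ℤ.+ f ≡ ℚᵘ.↥ R ℤ.* ℤ.+ 1
      rhs = trans (cong (λ x → x ℤ.* Q ℤ.- P ℤ.* ℤ.+ f) (ℤₚ.pos-* f k))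
        (solve 4 (λ f k Q P → f :* k :* Q :- P :* f := (k :* Q :+ (:- P) :* con (ℤ.+ 1)) :* f :* con (ℤ.+ 1))
          refl (ℤ.+ f) (ℤ.+ k) Q P)

  k*[m/k]≡m : ∀ k m .{{_ : ℕ.NonZero k}} → (ℤ.+ k / 1) ℚ.* (ℤ.+ m / k) ≡ ℤ.+ m / 1
  k*[m/k]≡m (suc k-1) m = ℚₚ.toℚᵘ-injective (begin
    ℚ.toℚᵘ ((ℤ.+ k / 1) ℚ.* (ℤ.+ m / k))                   ≈⟨ ℚₚ.toℚᵘ-homo-* (ℤ.+ k / 1) (ℤ.+ m / k) ⟩
    ℚ.toℚᵘ (ℤ.+ k / 1) ℚᵘ.* ℚ.toℚᵘ (ℤ.+ m / k)             ≈⟨ ℚᵘₚ.*-cong (ℚₚ.toℚᵘ-fromℚᵘ (mkℚᵘ (ℤ.+ k) 0))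
                                                                           (ℚₚ.toℚᵘ-fromℚᵘ (mkℚᵘ (ℤ.+ m) k-1)) ⟩
    mkℚᵘ (ℤ.+ k) 0 ℚᵘ.* mkℚᵘ (ℤ.+ m) k-1                   ≈⟨ ℚᵘ.*≡* cleared ⟩
    mkℚᵘ (ℤ.+ m) 0                                          ≈⟨ ℚₚ.toℚᵘ-fromℚᵘ (mkℚᵘ (ℤ.+ m) 0) ⟨
    ℚ.toℚᵘ (ℤ.+ m / 1)                                      ∎)
    where
    open ℚᵘₚ.≃-Reasoning
    open +-*-Solver
    k = suc k-1
    cleared : (ℤ.+ k ℤ.* ℤ.+ m) ℤ.* ℤ.+ 1 ≡ ℤ.+ m ℤ.* ℚᵘ.↧ (mkℚᵘ (ℤ.+ k) 0 ℚᵘ.* mkℚᵘ (ℤ.+ m) k-1)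
    cleared = trans (solve 2 (λ k m → k :* m :* con (ℤ.+ 1) := m :* k) refl (ℤ.+ k) (ℤ.+ m))
                    (cong (λ d → ℤ.+ m ℤ.* ℤ.+ suc d) (sym (ℕₚ.+-identityʳ k-1)))

  cutSize≤[k-a]*length : ∀ {k n} (G : Graph n) (S : Fin n → Bool) (xs : List (Fin n)) (a : ℚ) →
    (∀ (C : Cycle k) → a ℚ.≤ cycleRatio C) → IsRadiusSeq k G xs →
    ℤ.+ cutSize G S / 1 ℚ.≤ (ℤ.+ k / 1 ℚ.- a) ℚ.* (ℤ.+ length xs / 1)
  cutSize≤[k-a]*length {k} G S xs a a≤C R = m≤[k-a]*f a (cutSize G S) (length xs) k
    (cutSize-boundℤ {P = ℚ.↥ a} {Q = ℚ.↧ a} G S xs (λ C → ≤-cycleRatio⇒RatioAtLeast a C (a≤C C)) R)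

  ÷-rearrange : ∀ k m {D F} .{{_ : ℕ.NonZero k}} .{{_ : ℚ.NonZero D}} →
    ℚ.0ℚ ℚ.≤ D → ℤ.+ m / 1 ℚ.≤ D ℚ.* F → (ℤ.+ k / 1 ℚ.÷ D) ℚ.* (ℤ.+ m / k) ℚ.≤ F
  ÷-rearrange k m {D} {F} 0≤D m≤DF = begin
    (K ℚ.÷ D) ℚ.* (ℤ.+ m / k)         ≡⟨ cong (ℚ._* (ℤ.+ m / k)) (ℚₚ.*-comm K (ℚ.1/ D)) ⟩
    ℚ.1/ D ℚ.* K ℚ.* (ℤ.+ m / k)      ≡⟨ ℚₚ.*-assoc (ℚ.1/ D) K (ℤ.+ m / k) ⟩
    ℚ.1/ D ℚ.* (K ℚ.* (ℤ.+ m / k))    ≡⟨ cong (ℚ.1/ D ℚ.*_) (k*[m/k]≡m k m) ⟩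
    ℚ.1/ D ℚ.* (ℤ.+ m / 1)            ≤⟨ ℚₚ.*-monoˡ-≤-nonNeg (ℚ.1/ D) m≤DF ⟩
    ℚ.1/ D ℚ.* (D ℚ.* F)              ≡⟨ ℚₚ.*-assoc (ℚ.1/ D) D F ⟨
    ℚ.1/ D ℚ.* D ℚ.* F                ≡⟨ cong (ℚ._* F) (ℚₚ.*-inverseˡ D) ⟩
    ℚ.1ℚ ℚ.* F                        ≡⟨ ℚₚ.*-identityˡ F ⟩
    F                                 ∎
    where
    open ℚₚ.≤-Reasoning
    K = ℤ.+ k / 1
    instance
      D-pos : ℚ.Positive D
      D-pos = ℚₚ.nonNeg∧nonZero⇒pos D {{ℚ.nonNegative 0≤D}}
      1/D-pos : ℚ.Positive (ℚ.1/ D)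
      1/D-pos = ℚₚ.1/pos⇒pos D
      1/D-nonNeg : ℚ.NonNegative (ℚ.1/ D)
      1/D-nonNeg = ℚₚ.pos⇒nonNeg (ℚ.1/ D)

open import Defs
open import Data.Nat as ℕ using (ℕ)
open import Data.Integer using (+_)
open import Data.Rational as ℚ using (ℚ; _/_; _÷_; _*_; _-_; _≤_)
import Data.Rational.Properties as ℚₚ
open import Data.Product using (_,_)
open import Relation.Binary.PropositionalEquality using (refl; subst)

corollary2 : (k : ℕ) → .{{_ : ℕ.NonZero k}} →
    ∀ {n} (G : Graph n) (f m : ℕ) (a : ℚ) →
    IsFk k G f → IsMaxCut G m → IsAk k a →
    .{{_ : ℚ.NonZero ((+ k / 1) - a)}} →
    ((+ k / 1) ÷ ((+ k / 1) - a)) * ((+ m) / k) ≤ (+ f / 1)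
corollary2 k G f m a ((xs , R , refl) , _) ((S , refl) , _) ((C₀ , _) , a≤C) =
  ÷-rearrange k (cutSize G S) 0≤k-a (cutSize≤[k-a]*length G S xs a a≤C R)
  where
  0≤k-a : ℚ.0ℚ ≤ (+ k / 1) - a
  0≤k-a = subst (_≤ (+ k / 1) - a) (ℚₚ.+-inverseʳ a)
            (ℚₚ.+-monoˡ-≤ (ℚ.- a) (ℚₚ.≤-trans (a≤C C₀) (cycleRatio≤k C₀)))
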